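{- Let $\psi(\lambda)$ be a Boolean combination (using $\neg,\wedge,\vee$) of standard translations $\theta^*(\lambda)$ of $\mathsf{InqML}$-formulae $\theta$. Let $\mathcal C$ be the class of inquisitive closures $(\mathfrak M,s){\downarrow}$ of state-pointed relational pseudo-models $(\mathfrak M,s)$ with $s\neq\emptyset$. Suppose $\psi$ is persistent over $\mathcal C$, i.e. for every $(\mathfrak M,s){\downarrow}\in\mathcal C$ and every $t\subseteq s$, if $(\mathfrak M,s){\downarrow}\models\psi[s]$ then $(\mathfrak M,s){\downarrow}\models\psi[t]$. Then there is $\phi\in\mathsf{InqML}$ such that for every $(\mathfrak M,s){\downarrow}\in\mathcal C$: $(\mathfrak M,s){\downarrow}\models\psi[s]$ iff $(\mathfrak M,s){\downarrow}\models\phi^*[s]$.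
   Context: Fix an at most countable set of propositional variables $(p_i)_{i\in I}$. $\mathsf{InqML}$: $\phi::=p_i\mid\bot\mid(\phi\wedge\phi)\mid(\phi\to\phi)\mid(\phi\mathbin{\backslash\!/}\phi)\mid\Box\phi\mid\boxplus\phi$. Relational pseudo-model: two-sorted structure $\mathfrak M=(W,S,\epsilon,E,(P_i)_{i\in I})$, $\epsilon,E\subseteq W\times S$, $P_i\subseteq W$, with extensionality (states with the same $\epsilon$-members are equal) and $E[w]=\{s:(w,s)\in E\}\neq\emptyset$ for all $w$; identify $S\subseteq\mathcal P(W)$, $\epsilon$ as membership. A state-pointed one is $(\mathfrak M,s)$ with $s\in S$. Its inquisitive closure $(\mathfrak M,s){\downarrow}$ is the structure with worlds $W$, second sort $S\cup\{t: t\subseteq u\text{ for some }w\in W,u\in E[w]\}\cup\{t:t\subseteq s\}$, $\epsilon$ membership, $E{\downarrow}[w]=\{t:t\subseteq u\text{ for some }u\in E[w]\}$, same $P_i$. Standard translation: first-sort variables $x,y$, second-sort $\lambda,\mu$; $x\in\lambda$ abbreviates $\epsilon x\lambda$. Flatness grade: $\mathrm{fl}=0$ for $p_i,\bot,\Box\psi,\boxplus\psi$; $\mathrm{fl}(\psi\wedge\chi)=\max$; $\mathrm{fl}(\psi\to\chi)=\mathrm{fl}(\chi)$; $\mathrm{fl}(\psi\mathbin{\backslash\!/}\chi)=\mathrm{fl}\psi+\mathrm{fl}\chi+1$. For $\mathbf x=(x_1,..,x_n)$: $\mathrm{ST}(p_i,\mathbf x)=\bigwedge_kP_ix_k$; $\mathrm{ST}(\bot,\mathbf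 x)=\bigwedge_k\neg x_k=x_k$; $\mathrm{ST}(\psi\wedge\chi,\mathbf x)=\mathrm{ST}(\psi,\mathbf x)\wedge\mathrm{ST}(\chi,\mathbf x)$; $\mathrm{ST}(\psi\to\chi,\mathbf x)=\forall y_1..y_n[(\bigwedge_{k}\bigvee_{l}y_k=x_l)\to(\mathrm{ST}(\psi,\mathbf y)\to\mathrm{ST}(\chi,\mathbf y))]$; $\mathrm{ST}(\psi\mathbin{\backslash\!/}\chi,\mathbf x)=\mathrm{ST}(\psi,\mathbf x)\vee\mathrm{ST}(\chi,\mathbf x)$; with $m=\mathrm{fl}(\psi)+1$, $\mathrm{ST}(\Box\psi,\mathbf x)=\bigwedge_k\forall y_1..y_m\forall\mu_1..\mu_m(\bigwedge_{l\le m}(Ex_k\mu_l\wedge y_l\in\mu_l)\to\mathrm{ST}(\psi,(y_1..y_m)))$; $\mathrm{ST}(\boxplus\psi,\mathbf x)=\bigwedge_k\forall\mu(Ex_k\mu\to\psi^*(\mu))$, where for any formula $\theta$ with $m=\mathrm{fl}(\theta)+1$, $\theta^*(\lambda)=\forall x_1..x_m(\bigwedge_{k\le m}x_k\in\lambda\to\mathrm{ST}(\theta,(x_1..x_m)))$. -}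

module Defs where

open import Level using (Level; Lift; lift; 0ℓ) renaming (suc to lsuc)
open import Data.Nat using (ℕ; zero; suc; _+_; _⊔_)
open import Data.Fin using (Fin)
open import Data.Product using (Σ; _×_; _,_)
open import Data.Sum using (_⊎_; inj₁; inj₂)
open import Relation.Nullary using (¬_)
open import Relation.Binary.PropositionalEquality using (_≡_)

data Form (I : Set) : Set where
  atom    : I → Form I
  ⊥f      : Form I
  _∧f_    : Form I → Form I → Form I
  _⇒f_    : Form I → Form I → Form I
  _⩔f_    : Form I → Form I → Form I
  □f      : Form I → Form I
  ⊞f      : Form I → Form I

fl : {I : Set} → Form I → ℕ
fl (atom _)  = 0
fl ⊥f        = 0
fl (φ ∧f ψ)  = fl φ ⊔ fl ψ
fl (φ ⇒f ψ)  = fl ψ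
fl (φ ⩔f ψ)  = fl φ + fl ψ + 1
fl (□f _)    = 0
fl (⊞f _)    = 0

-- Two-sorted structures (signature: ε, E, (P_i)); no axioms needed
-- for evaluating first-order formulas.

record Struct (I : Set) : Set₂ where
  field
    W  : Set
    St : Set₁
    ε  : W → St → Set
    E  : W → St → Set
    P  : I → W → Set

-- Semantics of the standard translation: ST θ x holds in 𝔐 iff
-- 𝔐 ⊨ ST(θ, x) (tuples x = (x_1..x_n) as Fin n → W).
module _ {I : Set} (𝔐 : Struct I) where
  open Struct 𝔐

  mutual
    ST : Form I → {n : ℕ} → (Fin n → W) → Set₁
    ST (atom i) x = Lift (lsuc 0ℓ) (∀ k → P i (x k))
    ST ⊥f       x = Lift (lsuc 0ℓ) (∀ k → ¬ (x k ≡ x k))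
    ST (φ ∧f ψ) x = ST φ x × ST ψ x
    ST (φ ⇒f ψ) {n} x =
      (y : Fin n → W) → (∀ k → Σ (Fin n) (λ l → y k ≡ x l)) → ST φ y → ST ψ y
    ST (φ ⩔f ψ) x = ST φ x ⊎ ST ψ x
    ST (□f φ)   {n} x = (k : Fin n) →
      (y : Fin (suc (fl φ)) → W) → (μ : Fin (suc (fl φ)) → St) →
      (∀ l → E (x k) (μ l) × ε (y l) (μ l)) → ST φ y
    ST (⊞f φ)   {n} x = (k : Fin n) → (μ : St) → E (x k) μ → star φ μ

    star : Form I → St → Set₁
    star θ λ' = (x : Fin (suc (fl θ)) → W) → (∀ k → ε (x k) λ') → ST θ x

data BC (I : Set) : Set where
  ⟨_⟩*  : Form I → BC I
  ¬b_   : BC I → BC I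
  _∧b_  : BC I → BC I → BC I
  _∨b_  : BC I → BC I → BC I

evalBC : {I : Set} (𝔐 : Struct I) → BC I → Struct.St 𝔐 → Set₁
evalBC 𝔐 ⟨ θ ⟩* λ' = star 𝔐 θ λ'
evalBC 𝔐 (¬b b) λ' = ¬ evalBC 𝔐 b λ'
evalBC 𝔐 (b ∧b c) λ' = evalBC 𝔐 b λ' × evalBC 𝔐 c λ'
evalBC 𝔐 (b ∨b c) λ' = evalBC 𝔐 b λ' ⊎ evalBC 𝔐 c λ'

record PModel (I : Set) : Set₁ where
  field
    W   : Set
    St  : Set
    ε   : W → St → Set
    E   : W → St → Set
    P   : I → W → Set
    extensional : ∀ s t → (∀ w → (ε w s → ε w t) × (ε w t → ε w s)) → s ≡ t
    E-nonempty  : ∀ w → Σ St (E w)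

module _ {I : Set} (𝔐 : PModel I) where
  open PModel 𝔐

  Subset : Set₁
  Subset = W → Set

  _⊆_ : Subset → Subset → Set
  T ⊆ U = ∀ w → T w → U w

  ⟦_⟧ : St → Subset
  ⟦ u ⟧ w = ε w u

  -- states of the inquisitive closure (𝔐,s)↓ : subsets T of W that are
  -- (extensionally) an original state, or contained in some u ∈ E[w],
  -- or contained in s
  ClSt : St → Set₁
  ClSt s = Σ Subset λ T →
      Σ St (λ u → ∀ w → (T w → ε w u) × (ε w u → T w))
    ⊎ Σ W (λ w → Σ St (λ u → E w u × (T ⊆ ⟦ u ⟧)))
    ⊎ (T ⊆ ⟦ s ⟧)

  closure : St → Struct I
  closure s = record
    { W  = W
    ; St = ClSt s
    ; ε  = λ w t → Σ.proj₁ t w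
    ; E  = λ w t → Σ St (λ u → E w u × (Σ.proj₁ t ⊆ ⟦ u ⟧))
    ; P  = P
    }
    where open Data.Product

  sCl : (s : St) → ClSt s
  sCl s = ⟦ s ⟧ , inj₁ (s , λ w → (λ p → p) , (λ p → p))

  subCl : (s : St) (T : Subset) → T ⊆ ⟦ s ⟧ → ClSt s
  subCl s T T⊆s = T , inj₂ (inj₂ T⊆s)

  NonEmpty : St → Set
  NonEmpty s = Σ W (λ w → ε w s)

Persistent : {I : Set} → BC I → Set₁
Persistent {I} ψ = (𝔐 : PModel I) (s : PModel.St 𝔐) → NonEmpty 𝔐 s →
  (T : Subset 𝔐) (T⊆s : _⊆_ 𝔐 T (⟦_⟧ 𝔐 s)) →
  evalBC (closure 𝔐 s) ψ (sCl 𝔐 s) → evalBC (closure 𝔐 s) ψ (subCl 𝔐 s T T⊆s)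

-- Read ψ as a propositional formula over the atoms θ*(λ) and bring it into conjunctive
-- normal form, a conjunction of clauses ⋀N → ⋁P; the InqML formula φ is the conjunction
-- of the formulas ⋀N → ⩔P. Two facts about the standard translation make this work.
-- First, ST(θ, x) only depends on the set of entries of x (and holds for the empty
-- tuple). Second (flatness), θ* holds at a state iff ST(θ, x) holds for every tuple x
-- from it, of any length. Hence (⋀N → ⩔P)* holds at s iff the clause ⋀N → ⋁P holds at
-- every state spanned by finitely many worlds of s; these states belong to (𝔐,s)↓, so
-- by persistence of ψ every clause holds at them whenever ψ holds at s. Conversely, taking
-- the state s itself, φ* at s yields every clause at s, hence ψ; here s ≠ ∅ is needed
-- to refute the empty disjunction. The argument is classical throughout.
module Submission where

open import Defs
open import Level using (0ℓ; Lift; lift; lower) renaming (suc to lsuc)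
open import Axiom.ExcludedMiddle using (ExcludedMiddle)
open import Axiom.DoubleNegationElimination using (em⇒dne)
open import Data.Nat using (ℕ; zero; suc; _+_; _≤_; z≤n; s≤s)
open import Data.Nat.Properties using (m≤m⊔n; m≤n⊔m; +-assoc; +-comm)
open import Data.Fin using (Fin; zero; suc)
import Data.Vec.Functional as Vec
import Data.Vec.Functional.Relation.Unary.All as V
import Data.Vec.Functional.Relation.Unary.All.Properties as Vₚ
open import Data.List using (List; []; _∷_; _++_; map; cartesianProductWith)
open import Data.List.Relation.Unary.All as All using (All; []; _∷_)
import Data.List.Relation.Unary.All.Properties as Allₚ
open import Data.List.Relation.Unary.Any as Any using (Any; here; there)
import Data.List.Relation.Unary.Any.Properties as Anyₚ
open import Data.List.Membership.Propositional.Properties using (∈-cartesianProductWith⁺)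
open import Data.Product using (Σ; _×_; _,_; proj₁; proj₂)
open import Data.Sum as Sum using (_⊎_; inj₁; inj₂)
open import Data.Empty using (⊥-elim)
open import Function using (_∘_)
open import Function.Bundles using (_↣_; _⇔_; mk⇔; Equivalence)
open import Relation.Nullary using (¬_; yes; no)
open import Relation.Unary using (_⊆′_)
open import Relation.Binary.PropositionalEquality as ≡ using (_≡_; refl; sym; trans; cong; subst)

open Equivalence using (to; from)

clamp : ∀ {a b} → a ≤ b → Fin (suc b) → Fin (suc a)
clamp z≤n       _       = zero
clamp (s≤s a≤b) zero    = zero
clamp (s≤s a≤b) (suc j) = suc (clamp a≤b j)

clamp-surjective : ∀ {a b} (a≤b : a ≤ b) (k : Fin (suc a)) →
                   Σ (Fin (suc b)) λ j → clamp a≤b j ≡ k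
clamp-surjective z≤n       zero    = zero , refl
clamp-surjective (s≤s a≤b) zero    = zero , refl
clamp-surjective (s≤s a≤b) (suc k) =
  let j , e = clamp-surjective a≤b k in suc j , cong suc e

conjᶠ : {I : Set} → List (Form I) → Form I
conjᶠ []       = ⊥f ⇒f ⊥f
conjᶠ (θ ∷ θs) = θ ∧f conjᶠ θs

disjᶠ : {I : Set} → List (Form I) → Form I
disjᶠ []       = ⊥f
disjᶠ (θ ∷ θs) = θ ⩔f disjᶠ θs

Clause : Set → Set
Clause I = List (Form I) × List (Form I)

Sat : {I : Set} → (Form I → Set₁) → Clause I → Set₁
Sat A (N , P) = All A N → Any A P

clauseᶠ : {I : Set} → Clause I → Form I
clauseᶠ (N , P) = conjᶠ N ⇒f disjᶠ P

cnfᶠ : {I : Set} → List (Clause I) → Form I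
cnfᶠ cs = conjᶠ (map clauseᶠ cs)

module Semantics (em : ExcludedMiddle (lsuc 0ℓ)) {I : Set} (𝔐 : Struct I) where
  open Struct 𝔐

  private
    dne = em⇒dne em

  Entries : ∀ {n} → (Fin n → W) → W → Set
  Entries {n} y w = Σ (Fin n) λ l → w ≡ y l

  _⊑_ : ∀ {m n} → (Fin m → W) → (Fin n → W) → Set
  z ⊑ y = V.All (Entries y) z

  All-⊑ : ∀ {ℓ} (D : W → Set ℓ) {m n} {y : Fin n → W} {z : Fin m → W} →
          V.All D y → z ⊑ y → V.All D z
  All-⊑ D Dy z⊑y k = let l , e = z⊑y k in subst D (sym e) (Dy l)

  ⊑-refl : ∀ {n} (y : Fin n → W) → y ⊑ y
  ⊑-refl y k = k , refl

  ⊑-trans : ∀ {m n o} {x : Fin m → W} {y : Fin n → W} {z : Fin o → W} →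
            x ⊑ y → y ⊑ z → x ⊑ z
  ⊑-trans {z = z} x⊑y y⊑z = All-⊑ (Entries z) y⊑z x⊑y

  ⊑-++ˡ : ∀ {m n} (y : Fin m → W) (z : Fin n → W) → y ⊑ (y Vec.++ z)
  ⊑-++ˡ y z = Vₚ.++⁻ˡ (Entries (y Vec.++ z)) y (⊑-refl (y Vec.++ z))

  ⊑-++ʳ : ∀ {m n} (y : Fin m → W) (z : Fin n → W) → z ⊑ (y Vec.++ z)
  ⊑-++ʳ y z = Vₚ.++⁻ʳ (Entries (y Vec.++ z)) y (⊑-refl (y Vec.++ z))

  resize : ∀ {m n} (y′ : Fin (suc m) → W) (y : Fin n → W) → y′ ⊑ y →
           Σ (Fin n → W) λ y″ → y″ ⊑ y′ × y′ ⊑ y″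
  resize {n = n} y′ y y′⊑y = y″ , (λ l → proj₁ (proj₂ (retract (y l)))) , y′⊑y″
    where
    retract : (w : W) → Σ W λ v → Entries y′ v × (Entries y′ w → v ≡ w)
    retract w with em {Lift (lsuc 0ℓ) (Entries y′ w)}
    ... | yes (lift w∈y′) = w , w∈y′ , λ _ → refl
    ... | no w∉y′ = y′ zero , (zero , refl) , λ w∈y′ → ⊥-elim (w∉y′ (lift w∈y′))
    y″ : Fin n → W
    y″ l = proj₁ (retract (y l))
    y′⊑y″ : y′ ⊑ y″
    y′⊑y″ k = let l , e = y′⊑y k in
      l , trans e (sym (proj₂ (proj₂ (retract (y l))) (k , sym e)))

  ST-empty : ∀ θ (x : Fin 0 → W) → ST 𝔐 θ x
  ST-empty (atom i) x = lift λ ()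
  ST-empty ⊥f       x = lift λ ()
  ST-empty (φ ∧f χ) x = ST-empty φ x , ST-empty χ x
  ST-empty (φ ⇒f χ) x = λ y _ _ → ST-empty χ y
  ST-empty (φ ⩔f χ) x = inj₁ (ST-empty φ x)
  ST-empty (□f φ)   x = λ ()
  ST-empty (⊞f φ)   x = λ ()

  ST-persistent : ∀ θ {m n} {y : Fin n → W} {z : Fin m → W} →
                  ST 𝔐 θ y → z ⊑ y → ST 𝔐 θ z
  ST-persistent (atom i) (lift Py) z⊑y = lift (All-⊑ (P i) Py z⊑y)
  ST-persistent ⊥f (lift ≢y) z⊑y = lift λ k _ → ≢y (proj₁ (z⊑y k)) refl
  ST-persistent (φ ∧f χ) (φy , χy) z⊑y = ST-persistent φ φy z⊑y , ST-persistent χ χy z⊑y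
  ST-persistent (φ ⩔f χ) (inj₁ φy) z⊑y = inj₁ (ST-persistent φ φy z⊑y)
  ST-persistent (φ ⩔f χ) (inj₂ χy) z⊑y = inj₂ (ST-persistent χ χy z⊑y)
  ST-persistent (φ ⇒f χ) {zero} _ _ y′ _ _ = ST-empty χ y′
  ST-persistent (φ ⇒f χ) {suc m} {y = y} φ⇒χy z⊑y y′ y′⊑z φy′ =
    let y′⊑y            = ⊑-trans y′⊑z z⊑y
        y″ , y″⊑y′ , y′⊑y″ = resize y′ y y′⊑y
    in ST-persistent χ (φ⇒χy y″ (⊑-trans y″⊑y′ y′⊑y) (ST-persistent φ φy′ y″⊑y′)) y′⊑y″
  ST-persistent (□f φ) □y z⊑y =
    All-⊑ (λ w → ∀ y μ → (∀ l → E w (μ l) × ε (y l) (μ l)) → ST 𝔐 φ y) □y z⊑y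
  ST-persistent (⊞f φ) ⊞y z⊑y = All-⊑ (λ w → ∀ μ → E w μ → star 𝔐 φ μ) ⊞y z⊑y

  ValidOn : ℕ → Form I → (W → Set) → Set₁
  ValidOn n θ D = (x : Fin n → W) → V.All D x → ST 𝔐 θ x

  _⊨*_ : (W → Set) → Form I → Set₁
  D ⊨* θ = ValidOn (suc (fl θ)) θ D

  ValidOn-≤ : ∀ θ D {a b} → a ≤ b → ValidOn (suc b) θ D → ValidOn (suc a) θ D
  ValidOn-≤ θ D a≤b valid z z∈D =
    ST-persistent θ (valid (z ∘ clamp a≤b) (z∈D ∘ clamp a≤b)) λ k →
      let j , e = clamp-surjective a≤b k in j , cong z (sym e)

  counterexample : ∀ {n} θ D → ¬ ValidOn n θ D →
                   Σ (Fin n → W) λ x → V.All D x × ¬ ST 𝔐 θ x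
  counterexample θ D ¬valid = dne λ none → ¬valid λ x x∈D → dne λ ¬θx → none (x , x∈D , ¬θx)

  -- A counterexample to φ followed by an arbitrary tuple still fits the bound of φ ⩔ χ.
  ValidOn-⩔ : ∀ φ χ D → D ⊨* (φ ⩔f χ) → D ⊨* φ ⊎ D ⊨* χ
  ValidOn-⩔ φ χ D valid with em {D ⊨* φ}
  ... | yes φ-valid = inj₁ φ-valid
  ... | no ¬φ-valid = inj₂ χ-valid
    where
    bound : fl φ + fl χ + 1 ≡ fl φ + suc (fl χ)
    bound = trans (+-assoc (fl φ) (fl χ) 1) (cong (fl φ +_) (+-comm (fl χ) 1))
    valid′ : ValidOn (suc (fl φ) + suc (fl χ)) (φ ⩔f χ) D
    valid′ = subst (λ n → ValidOn (suc n) (φ ⩔f χ) D) bound valid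
    χ-valid : D ⊨* χ
    χ-valid z₂ z₂∈D with counterexample φ D ¬φ-valid
    ... | z₁ , z₁∈D , ¬φz₁ with valid′ (z₁ Vec.++ z₂) (Vₚ.++⁺ D z₁∈D z₂∈D)
    ...   | inj₁ φz = ⊥-elim (¬φz₁ (ST-persistent φ φz (⊑-++ˡ z₁ z₂)))
    ...   | inj₂ χz = ST-persistent χ χz (⊑-++ʳ z₁ z₂)

  flatness : ∀ θ D → D ⊨* θ → ∀ {n} → ValidOn n θ D
  flatness (atom i) D valid y y∈D = lift λ k → lower (valid (λ _ → y k) (λ _ → y∈D k)) zero
  flatness ⊥f       D valid y y∈D = lift λ k → lower (valid (λ _ → y k) (λ _ → y∈D k)) zero
  flatness (φ ∧f χ) D valid y y∈D =
      flatness φ D (ValidOn-≤ φ D (m≤m⊔n (fl φ) (fl χ)) (λ z z∈D → proj₁ (valid z z∈D))) y y∈D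
    , flatness χ D (ValidOn-≤ χ D (m≤n⊔m (fl φ) (fl χ)) (λ z z∈D → proj₂ (valid z z∈D))) y y∈D
  flatness (φ ⇒f χ) D valid y y∈D y′ y′⊑y φy′ =
    flatness χ (Entries y′)
      (λ z z⊑y′ → valid z (All-⊑ D (All-⊑ D y∈D y′⊑y) z⊑y′) z (⊑-refl z) (ST-persistent φ φy′ z⊑y′))
      y′ (⊑-refl y′)
  flatness (φ ⩔f χ) D valid y y∈D with ValidOn-⩔ φ χ D valid
  ... | inj₁ φ-valid = inj₁ (flatness φ D φ-valid y y∈D)
  ... | inj₂ χ-valid = inj₂ (flatness χ D χ-valid y y∈D)
  flatness (□f φ)   D valid y y∈D k = valid (λ _ → y k) (λ _ → y∈D k) zero
  flatness (⊞f φ)   D valid y y∈D k = valid (λ _ → y k) (λ _ → y∈D k) zero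

  ST-conjᶠ⁺ : ∀ θs {n} {y : Fin n → W} → All (λ θ → ST 𝔐 θ y) θs → ST 𝔐 (conjᶠ θs) y
  ST-conjᶠ⁺ []       []         = λ _ _ ⊥y → ⊥y
  ST-conjᶠ⁺ (θ ∷ θs) (θy ∷ θsy) = θy , ST-conjᶠ⁺ θs θsy

  ST-conjᶠ⁻ : ∀ θs {n} {y : Fin n → W} → ST 𝔐 (conjᶠ θs) y → All (λ θ → ST 𝔐 θ y) θs
  ST-conjᶠ⁻ []       _          = []
  ST-conjᶠ⁻ (θ ∷ θs) (θy , θsy) = θy ∷ ST-conjᶠ⁻ θs θsy

  ST-disjᶠ⁺ : ∀ θs {n} {y : Fin n → W} → Any (λ θ → ST 𝔐 θ y) θs → ST 𝔐 (disjᶠ θs) y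
  ST-disjᶠ⁺ (θ ∷ θs) (here θy)  = inj₁ θy
  ST-disjᶠ⁺ (θ ∷ θs) (there θy) = inj₂ (ST-disjᶠ⁺ θs θy)

  ValidOn-disjᶠ : ∀ θs D → Σ W D → (∀ {n} → ValidOn n (disjᶠ θs) D) → Any (D ⊨*_) θs
  ValidOn-disjᶠ [] D (w , w∈D) valid = ⊥-elim (lower (valid {1} (λ _ → w) (λ _ → w∈D)) zero refl)
  ValidOn-disjᶠ (θ ∷ θs) D w∈D valid with ValidOn-⩔ θ (disjᶠ θs) D valid
  ... | inj₁ θ-valid  = here θ-valid
  ... | inj₂ θs-valid = there (ValidOn-disjᶠ θs D w∈D (flatness (disjᶠ θs) D θs-valid))

  -- The clause is applied at the state spanned by the entries of y′.
  clauseᶠ-intro : ∀ c D → (∀ T → T ⊆′ D → Sat (T ⊨*_) c) → ∀ {n} → ValidOn n (clauseᶠ c) D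
  clauseᶠ-intro (N , P) D sat y y∈D y′ y′⊑y Ny′ =
    ST-disjᶠ⁺ P (Any.map (λ {θ} y′⊨θ → flatness θ (Entries y′) y′⊨θ y′ (⊑-refl y′))
                         (sat (Entries y′) y′⊆D y′⊨N))
    where
    y′⊆D : Entries y′ ⊆′ D
    y′⊆D w (l , refl) = All-⊑ D y∈D y′⊑y l
    y′⊨N : All (Entries y′ ⊨*_) N
    y′⊨N = All.map (λ {θ} θy′ z z⊑y′ → ST-persistent θ θy′ z⊑y′) (ST-conjᶠ⁻ N Ny′)

  clauseᶠ-elim : ∀ c D → Σ W D → (∀ {n} → ValidOn n (clauseᶠ c) D) → Sat (D ⊨*_) c
  clauseᶠ-elim (N , P) D w∈D valid D⊨N = ValidOn-disjᶠ P D w∈D λ y y∈D →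
    valid y y∈D y (⊑-refl y) (ST-conjᶠ⁺ N (All.map (λ {θ} D⊨θ → flatness θ D D⊨θ y y∈D) D⊨N))

  cnfᶠ-intro : ∀ cs D → (∀ T → T ⊆′ D → All (Sat (T ⊨*_)) cs) → D ⊨* cnfᶠ cs
  cnfᶠ-intro cs D sat y y∈D = ST-conjᶠ⁺ (map clauseᶠ cs) (Allₚ.map⁺ (All.tabulate λ {c} c∈cs →
    clauseᶠ-intro c D (λ T T⊆D → All.lookup (sat T T⊆D) c∈cs) y y∈D))

  cnfᶠ-elim : ∀ cs D → Σ W D → D ⊨* cnfᶠ cs → All (Sat (D ⊨*_)) cs
  cnfᶠ-elim cs D w∈D valid = All.tabulate λ {c} c∈cs → clauseᶠ-elim c D w∈D λ y y∈D →
    All.lookup (Allₚ.map⁻ (ST-conjᶠ⁻ (map clauseᶠ cs) (flatness (cnfᶠ cs) D valid y y∈D))) c∈cs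

_⊕_ : {I : Set} → Clause I → Clause I → Clause I
(N₁ , P₁) ⊕ (N₂ , P₂) = N₁ ++ N₂ , P₁ ++ P₂

_⊗_ : {I : Set} → List (Clause I) → List (Clause I) → List (Clause I)
_⊗_ = cartesianProductWith _⊕_

mutual
  cnf⁺ : {I : Set} → BC I → List (Clause I)
  cnf⁺ ⟨ θ ⟩*   = ([] , θ ∷ []) ∷ []
  cnf⁺ (¬b ψ)   = cnf⁻ ψ
  cnf⁺ (ψ ∧b χ) = cnf⁺ ψ ++ cnf⁺ χ
  cnf⁺ (ψ ∨b χ) = cnf⁺ ψ ⊗ cnf⁺ χ

  cnf⁻ : {I : Set} → BC I → List (Clause I)
  cnf⁻ ⟨ θ ⟩*   = (θ ∷ [] , []) ∷ []
  cnf⁻ (¬b ψ)   = cnf⁺ ψ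
  cnf⁻ (ψ ∧b χ) = cnf⁻ ψ ⊗ cnf⁻ χ
  cnf⁻ (ψ ∨b χ) = cnf⁻ ψ ++ cnf⁻ χ

module ClauseLogic (em : ExcludedMiddle (lsuc 0ℓ)) {I : Set} (A : Form I → Set₁) where

  private
    dne = em⇒dne em

  ⊕-intro : ∀ c d → Sat A c ⊎ Sat A d → Sat A (c ⊕ d)
  ⊕-intro (N₁ , P₁) (N₂ , P₂) (inj₁ sat) AN = Anyₚ.++⁺ˡ (sat (Allₚ.++⁻ˡ N₁ AN))
  ⊕-intro (N₁ , P₁) (N₂ , P₂) (inj₂ sat) AN = Anyₚ.++⁺ʳ P₁ (sat (Allₚ.++⁻ʳ N₁ AN))

  ⊕-elim : ∀ c d → Sat A (c ⊕ d) → Sat A c ⊎ Sat A d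
  ⊕-elim (N₁ , P₁) (N₂ , P₂) sat with em {All A N₁} | em {All A N₂}
  ... | no ¬AN₁ | _       = inj₁ (⊥-elim ∘ ¬AN₁)
  ... | yes _   | no ¬AN₂ = inj₂ (⊥-elim ∘ ¬AN₂)
  ... | yes AN₁ | yes AN₂ =
    Sum.map (λ AP₁ _ → AP₁) (λ AP₂ _ → AP₂) (Anyₚ.++⁻ P₁ (sat (Allₚ.++⁺ AN₁ AN₂)))

  ⊗-intro : ∀ cs ds → All (Sat A) cs ⊎ All (Sat A) ds → All (Sat A) (cs ⊗ ds)
  ⊗-intro cs ds sat = Allₚ.cartesianProductWith⁺ (≡.setoid _) (≡.setoid _) _⊕_ cs ds
    λ {c} {d} c∈cs d∈ds →
      ⊕-intro c d (Sum.map (λ sat-cs → All.lookup sat-cs c∈cs)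
                           (λ sat-ds → All.lookup sat-ds d∈ds) sat)

  ⊗-elim : ∀ cs ds → All (Sat A) (cs ⊗ ds) → All (Sat A) cs ⊎ All (Sat A) ds
  ⊗-elim cs ds sat with em {All (Sat A) ds}
  ... | yes sat-ds = inj₂ sat-ds
  ... | no ¬sat-ds = inj₁ (All.tabulate λ {c} c∈cs → dne λ ¬sat-c →
    ¬sat-ds (All.tabulate λ {d} d∈ds →
      Sum.[ ⊥-elim ∘ ¬sat-c , (λ sat-d → sat-d) ]′
        (⊕-elim c d (All.lookup sat (∈-cartesianProductWith⁺ _⊕_ c∈cs d∈ds)))))

module NormalForm (em : ExcludedMiddle (lsuc 0ℓ)) {I : Set} (𝔐 : Struct I) (λ′ : Struct.St 𝔐) where

  private
    dne = em⇒dne em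
    A : Form I → Set₁
    A θ = star 𝔐 θ λ′
    ⟦_⟧ᵇ : BC I → Set₁
    ⟦ ψ ⟧ᵇ = evalBC 𝔐 ψ λ′

  open ClauseLogic em A

  ¬×⇒¬⊎¬ : ∀ {P Q : Set₁} → ¬ (P × Q) → ¬ P ⊎ ¬ Q
  ¬×⇒¬⊎¬ ¬PQ = dne λ ¬[¬P⊎¬Q] → ¬PQ (dne (¬[¬P⊎¬Q] ∘ inj₁) , dne (¬[¬P⊎¬Q] ∘ inj₂))

  mutual
    cnf⁺-correct : ∀ ψ → ⟦ ψ ⟧ᵇ ⇔ All (Sat A) (cnf⁺ ψ)
    cnf⁺-correct ⟨ θ ⟩* = mk⇔
      (λ θ* → (λ _ → here θ*) ∷ [])
      (λ { (sat ∷ []) → Anyₚ.singleton⁻ (sat []) })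
    cnf⁺-correct (¬b ψ) = cnf⁻-correct ψ
    cnf⁺-correct (ψ ∧b χ) = mk⇔
      (λ (ψ-true , χ-true) → Allₚ.++⁺ (to (cnf⁺-correct ψ) ψ-true) (to (cnf⁺-correct χ) χ-true))
      (λ sat → from (cnf⁺-correct ψ) (Allₚ.++⁻ˡ (cnf⁺ ψ) sat)
             , from (cnf⁺-correct χ) (Allₚ.++⁻ʳ (cnf⁺ ψ) sat))
    cnf⁺-correct (ψ ∨b χ) = mk⇔
      (λ ψ∨χ → ⊗-intro (cnf⁺ ψ) (cnf⁺ χ) (Sum.map (to (cnf⁺-correct ψ)) (to (cnf⁺-correct χ)) ψ∨χ))
      (λ sat → Sum.map (from (cnf⁺-correct ψ)) (from (cnf⁺-correct χ))
                       (⊗-elim (cnf⁺ ψ) (cnf⁺ χ) sat))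

    cnf⁻-correct : ∀ ψ → (¬ ⟦ ψ ⟧ᵇ) ⇔ All (Sat A) (cnf⁻ ψ)
    cnf⁻-correct ⟨ θ ⟩* = mk⇔
      (λ ¬θ* → (λ { (θ* ∷ []) → ⊥-elim (¬θ* θ*) }) ∷ [])
      (λ { (sat ∷ []) θ* → Anyₚ.¬Any[] (sat (θ* ∷ [])) })
    cnf⁻-correct (¬b ψ) = mk⇔
      (λ ¬¬ψ → to (cnf⁺-correct ψ) (dne ¬¬ψ))
      (λ sat ¬ψ → ¬ψ (from (cnf⁺-correct ψ) sat))
    cnf⁻-correct (ψ ∧b χ) = mk⇔
      (λ ¬ψ∧χ → ⊗-intro (cnf⁻ ψ) (cnf⁻ χ)
                  (Sum.map (to (cnf⁻-correct ψ)) (to (cnf⁻-correct χ)) (¬×⇒¬⊎¬ ¬ψ∧χ)))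
      (λ sat → Sum.[ (λ ¬ψ → ¬ψ ∘ proj₁) , (λ ¬χ → ¬χ ∘ proj₂) ]′
                 (Sum.map (from (cnf⁻-correct ψ)) (from (cnf⁻-correct χ))
                          (⊗-elim (cnf⁻ ψ) (cnf⁻ χ) sat)))
    cnf⁻-correct (ψ ∨b χ) = mk⇔
      (λ ¬ψ∨χ → Allₚ.++⁺ (to (cnf⁻-correct ψ) (¬ψ∨χ ∘ inj₁)) (to (cnf⁻-correct χ) (¬ψ∨χ ∘ inj₂)))
      (λ sat → Sum.[ from (cnf⁻-correct ψ) (Allₚ.++⁻ˡ (cnf⁻ ψ) sat)
                   , from (cnf⁻-correct χ) (Allₚ.++⁻ʳ (cnf⁻ ψ) sat) ]′)

lemma5p10 : ExcludedMiddle (lsuc 0ℓ) →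
    (I : Set) → I ↣ ℕ → (ψ : BC I) → Persistent ψ →
    Σ (Form I) λ φ → (𝔐 : PModel I) (s : PModel.St 𝔐) → NonEmpty 𝔐 s →
      (evalBC (closure 𝔐 s) ψ (sCl 𝔐 s) → star (closure 𝔐 s) φ (sCl 𝔐 s))
      × (star (closure 𝔐 s) φ (sCl 𝔐 s) → evalBC (closure 𝔐 s) ψ (sCl 𝔐 s))
lemma5p10 em I _ ψ persistent = cnfᶠ (cnf⁺ ψ) , λ 𝔐 s s≢∅ →
  let open Semantics em (closure 𝔐 s)
      open NormalForm em (closure 𝔐 s)
  in (λ ψ-at-s → cnfᶠ-intro (cnf⁺ ψ) (⟦_⟧ 𝔐 s) λ T T⊆s →
        to (cnf⁺-correct (subCl 𝔐 s T T⊆s) ψ) (persistent 𝔐 s s≢∅ T T⊆s ψ-at-s))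
   , (λ φ-at-s → from (cnf⁺-correct (sCl 𝔐 s) ψ) (cnfᶠ-elim (cnf⁺ ψ) (⟦_⟧ 𝔐 s) s≢∅ φ-at-s))
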